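{- Let $c,i,s,t$ be nonnegative integers with $c\ge 1$ odd. Then: (i) If $1\le i<c2^s$ and $\nu_2(i)<s$, then $$\nu_2\left(\binom{c2^s}{i}\right)\ge s-\nu_2(i),$$ with equality if and only if $s_2\big(c-1-\lfloor i/2^s\rfloor\big)+s_2\big(\lfloor i/2^s\rfloor\big)=s_2(c-1)$. (ii) If $3\le i<c2^s$ and $t\ge 2$, then $$\nu_2\left(2^{ti}\binom{c2^s}{i}\right)\ge s+6.$$
   Context: For a nonzero integer $m$, $\nu_2(m)$ denotes the 2-adic valuation of $m$. For a nonnegative integer $k$, $s_2(k)$ denotes the sum of the binary digits of $k$. $\lfloor x\rfloor$ is the greatest integer not exceeding $x$. -}

module Defs where

open import Data.Nat using (ℕ; zero; suc; _+_; _*_; _/_; _%_)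

ν₂-fuel : ℕ → ℕ → ℕ
ν₂-fuel zero    m = zero
ν₂-fuel (suc f) zero = zero
ν₂-fuel (suc f) (suc m) with (suc m) % 2
... | zero  = suc (ν₂-fuel f ((suc m) / 2))
... | suc _ = zero

-- ν₂ m : 2-adic valuation of m (for m ≥ 1; fuel m suffices since ν₂ m ≤ m).
-- Convention ν₂ 0 = 0 (never used: only applied to nonzero numbers).
ν₂ : ℕ → ℕ
ν₂ m = ν₂-fuel m m

s₂-fuel : ℕ → ℕ → ℕ
s₂-fuel zero    k = zero
s₂-fuel (suc f) k = k % 2 + s₂-fuel f (k / 2)

-- s₂ k : sum of binary digits of k (fuel k suffices: k halves each step)
s₂ : ℕ → ℕ
s₂ k = s₂-fuel k k

open import Data.Nat using (_^_)
open import Data.Nat.Properties using (m^n≢0)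

⌊_/2^_⌋ : ℕ → ℕ → ℕ
⌊ i /2^ s ⌋ = _/_ i (2 ^ s) {{m^n≢0 2 s}}

-- Legendre's formula ν₂(n!) = n − s₂(n) gives Kummer's formula
-- ν₂(n C k) = s₂(k) + s₂(n − k) − s₂(n). For n = c·2^s and i = q·2^s + r with 0 < r < 2^s,
-- the binary digits split: n − i = (c − 1 − q)·2^s + (2^s − r), where the low parts satisfy
-- s₂(r) + s₂(2^s − r) = s + 1 − ν₂(r), and s₂(c) = s₂(c − 1) + 1 because c is odd.
-- Hence ν₂(c·2^s C i) = ν₂((c − 1) C q) + s − ν₂(i), which gives (i), since by Kummer again
-- ν₂((c − 1) C q) = 0 exactly when s₂(c − 1 − q) + s₂(q) = s₂(c − 1). For (ii) it gives
-- ν₂(c·2^s C i) + ν₂(i) ≥ s, and ν₂(i) + 6 ≤ 2i once i ≥ 3.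
module Submission where

open import Defs
open import Data.Nat using (ℕ; zero; suc; _+_; _*_; _∸_; _^_; _/_; _≤_; _<_; _≥_; _%_)
open import Data.Nat.Combinatorics using (_C_)
open import Data.Product using (_×_)
open import Function.Bundles using (_⇔_)
open import Relation.Binary.PropositionalEquality using (_≡_)

open import Data.Empty using (⊥-elim)
open import Data.Nat.Base using (z≤n; s≤s; s≤s⁻¹; _!; NonZero)
open import Data.Nat.Combinatorics using (k![n∸k]!∣n!)
open import Data.Nat.Combinatorics.Specification using (nCk≡n!/k![n-k]!)
open import Data.Nat.DivMod
open import Data.Nat.Induction using (<-wellFounded)
open import Data.Nat.Properties
open import Data.Nat.Tactic.RingSolver using (solve-∀)
open import Data.Product using (_,_)
open import Function.Bundles using (mk⇔)
open import Function.Properties.Equivalence using () renaming (trans to ⇔-trans)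
open import Induction.WellFounded using (Acc; acc)
open import Relation.Binary.PropositionalEquality
  using (_≢_; refl; sym; trans; cong; cong₂; subst; module ≡-Reasoning)
open import Relation.Nullary using (yes; no)
open import Algebra.Properties.CommutativeSemigroup +-commutativeSemigroup
  using (xy∙z≈xz∙y; xy∙z≈zx∙y)

data EvenOdd : ℕ → Set where
  even : ∀ k → EvenOdd (2 * k)
  odd  : ∀ k → EvenOdd (1 + 2 * k)

evenOdd : ∀ n → EvenOdd n
evenOdd zero = even 0
evenOdd (suc n) with evenOdd n
... | even k = odd k
... | odd k  = subst EvenOdd (*-distribˡ-+ 2 1 k) (even (1 + k))

2*n%2≡0 : ∀ n → 2 * n % 2 ≡ 0
2*n%2≡0 n = trans (cong (_% 2) (*-comm 2 n)) (m*n%n≡0 n 2)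

2*n/2≡n : ∀ n → 2 * n / 2 ≡ n
2*n/2≡n n = trans (cong (_/ 2) (*-comm 2 n)) (m*n/n≡m n 2)

[1+2*n]%2≡1 : ∀ n → (1 + 2 * n) % 2 ≡ 1
[1+2*n]%2≡1 n = trans (cong (λ m → (1 + m) % 2) (*-comm 2 n)) ([m+kn]%n≡m%n 1 n 2)

[1+2*n]/2≡n : ∀ n → (1 + 2 * n) / 2 ≡ n
[1+2*n]/2≡n n = begin
  (1 + 2 * n) / 2        ≡⟨ cong (λ m → (1 + m) / 2) (*-comm 2 n) ⟩
  (1 + n * 2) / 2        ≡⟨ +-distrib-/ 1 (n * 2) 1+[n*2]%2<2 ⟩
  1 / 2 + n * 2 / 2      ≡⟨ m*n/n≡m n 2 ⟩
  n                      ∎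
  where
  open ≡-Reasoning
  1+[n*2]%2<2 : 1 % 2 + n * 2 % 2 < 2
  1+[n*2]%2<2 = subst (λ m → 1 + m < 2) (sym (m*n%n≡0 n 2)) ≤-refl

1+2*m≢2*n : ∀ m n → 1 + 2 * m ≢ 2 * n
1+2*m≢2*n m n eq with trans (sym ([1+2*n]%2≡1 m)) (trans (cong (_% 2) eq) (2*n%2≡0 n))
... | ()

[1+n]/2≤n : ∀ n → suc n / 2 ≤ n
[1+n]/2≤n n = s≤s⁻¹ (m/n<m (suc n) 2 (s≤s (s≤s z≤n)))

s₂-fuel-zero : ∀ f → s₂-fuel f 0 ≡ 0
s₂-fuel-zero zero    = refl
s₂-fuel-zero (suc f) = s₂-fuel-zero f

s₂-fuel-stable : ∀ f g n → n ≤ f → n ≤ g → s₂-fuel f n ≡ s₂-fuel g n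
s₂-fuel-stable zero    g       zero    _       _       = sym (s₂-fuel-zero g)
s₂-fuel-stable (suc f) zero    zero    _       _       = s₂-fuel-zero (suc f)
s₂-fuel-stable (suc f) (suc g) zero    _       _       = s₂-fuel-stable f g 0 z≤n z≤n
s₂-fuel-stable (suc f) (suc g) (suc n) (s≤s n≤f) (s≤s n≤g) =
  cong (suc n % 2 +_) (s₂-fuel-stable f g (suc n / 2)
    (≤-trans ([1+n]/2≤n n) n≤f) (≤-trans ([1+n]/2≤n n) n≤g))

s₂-unfold : ∀ n → s₂ n ≡ n % 2 + s₂ (n / 2)
s₂-unfold zero    = refl
s₂-unfold (suc n) =
  cong (suc n % 2 +_) (s₂-fuel-stable n (suc n / 2) (suc n / 2) ([1+n]/2≤n n) ≤-refl)

s₂-2* : ∀ n → s₂ (2 * n) ≡ s₂ n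
s₂-2* n = trans (s₂-unfold (2 * n)) (cong₂ _+_ (2*n%2≡0 n) (cong s₂ (2*n/2≡n n)))

s₂-1+2* : ∀ n → s₂ (1 + 2 * n) ≡ 1 + s₂ n
s₂-1+2* n = trans (s₂-unfold (1 + 2 * n)) (cong₂ _+_ ([1+2*n]%2≡1 n) (cong s₂ ([1+2*n]/2≡n n)))

ν₂-fuel-zero : ∀ f → ν₂-fuel f 0 ≡ 0
ν₂-fuel-zero zero    = refl
ν₂-fuel-zero (suc f) = refl

ν₂-fuel-stable : ∀ f g n → n ≤ f → n ≤ g → ν₂-fuel f n ≡ ν₂-fuel g n
ν₂-fuel-stable zero    g       zero    _         _         = sym (ν₂-fuel-zero g)
ν₂-fuel-stable (suc f) zero    zero    _         _         = refl
ν₂-fuel-stable (suc f) (suc g) zero    _         _         = refl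
ν₂-fuel-stable (suc f) (suc g) (suc n) (s≤s n≤f) (s≤s n≤g) with suc n % 2
... | zero  = cong suc (ν₂-fuel-stable f g (suc n / 2)
                (≤-trans ([1+n]/2≤n n) n≤f) (≤-trans ([1+n]/2≤n n) n≤g))
... | suc _ = refl

ν₂-even : ∀ n → 1 ≤ n → n % 2 ≡ 0 → ν₂ n ≡ 1 + ν₂ (n / 2)
ν₂-even (suc n) _ n%2≡0 with suc n % 2
... | zero = cong suc (ν₂-fuel-stable n (suc n / 2) (suc n / 2) ([1+n]/2≤n n) ≤-refl)
ν₂-even (suc n) _ () | suc _

ν₂-odd : ∀ n → n % 2 ≡ 1 → ν₂ n ≡ 0
ν₂-odd (suc n) n%2≡1 with suc n % 2
... | suc _ = refl
ν₂-odd (suc n) () | zero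

ν₂-2* : ∀ n → 1 ≤ n → ν₂ (2 * n) ≡ 1 + ν₂ n
ν₂-2* (suc n) _ = trans (ν₂-even (2 * suc n) (s≤s z≤n) (2*n%2≡0 (suc n)))
                        (cong (λ m → 1 + ν₂ m) (2*n/2≡n (suc n)))

ν₂-1+2* : ∀ n → ν₂ (1 + 2 * n) ≡ 0
ν₂-1+2* n = ν₂-odd (1 + 2 * n) ([1+2*n]%2≡1 n)

ν₂-2^ : ∀ s → ν₂ (2 ^ s) ≡ s
ν₂-2^ zero    = refl
ν₂-2^ (suc s) = trans (ν₂-2* (2 ^ s) (m^n>0 2 s)) (cong suc (ν₂-2^ s))

n<2*n : ∀ n → 1 ≤ n → n < 2 * n
n<2*n n 1≤n = m<m+n n (≤-trans 1≤n (m≤m+n n 0))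

ν₂[n]<n : ∀ n → 1 ≤ n → ν₂ n < n
ν₂[n]<n n = go n (<-wellFounded n)
  where
  go : ∀ n → Acc _<_ n → 1 ≤ n → ν₂ n < n
  go n (acc rec) 1≤n with evenOdd n
  ... | even zero      = ⊥-elim (<-irrefl refl 1≤n)
  ... | even k@(suc _) = subst (_< 2 * k) (sym (ν₂-2* k (s≤s z≤n)))
                           (≤-trans (s≤s (go k (rec (n<2*n k (s≤s z≤n))) (s≤s z≤n)))
                                    (n<2*n k (s≤s z≤n)))
  ... | odd k          = subst (_< 1 + 2 * k) (sym (ν₂-1+2* k)) (s≤s z≤n)

ν₂-odd* : ∀ k b → 1 ≤ b → ν₂ ((1 + 2 * k) * b) ≡ ν₂ b
ν₂-odd* k b = go b (<-wellFounded b)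
  where
  open ≡-Reasoning
  u = 1 + 2 * k
  u*[2*j]≡2*[u*j] : ∀ u j → u * (2 * j) ≡ 2 * (u * j)
  u*[2*j]≡2*[u*j] = solve-∀
  odd*odd : ∀ k j → (1 + 2 * k) * (1 + 2 * j) ≡ 1 + 2 * (k + j + 2 * k * j)
  odd*odd = solve-∀
  go : ∀ b → Acc _<_ b → 1 ≤ b → ν₂ (u * b) ≡ ν₂ b
  go b (acc rec) 1≤b with evenOdd b
  ... | even zero      = ⊥-elim (<-irrefl refl 1≤b)
  ... | even j@(suc _) = begin
    ν₂ (u * (2 * j))  ≡⟨ cong ν₂ (u*[2*j]≡2*[u*j] u j) ⟩
    ν₂ (2 * (u * j))  ≡⟨ ν₂-2* (u * j) (*-mono-≤ {1} {u} (s≤s z≤n) (s≤s z≤n)) ⟩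
    1 + ν₂ (u * j)    ≡⟨ cong suc (go j (rec (n<2*n j (s≤s z≤n))) (s≤s z≤n)) ⟩
    1 + ν₂ j          ≡⟨ ν₂-2* j (s≤s z≤n) ⟨
    ν₂ (2 * j)        ∎
  ... | odd j = begin
    ν₂ (u * (1 + 2 * j))               ≡⟨ cong ν₂ (odd*odd k j) ⟩
    ν₂ (1 + 2 * (k + j + 2 * k * j))   ≡⟨ ν₂-1+2* (k + j + 2 * k * j) ⟩
    0                                  ≡⟨ ν₂-1+2* j ⟨
    ν₂ (1 + 2 * j)                     ∎

ν₂-* : ∀ a b → 1 ≤ a → 1 ≤ b → ν₂ (a * b) ≡ ν₂ a + ν₂ b
ν₂-* a b 1≤a 1≤b = go a (<-wellFounded a) 1≤a
  where
  open ≡-Reasoning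
  go : ∀ a → Acc _<_ a → 1 ≤ a → ν₂ (a * b) ≡ ν₂ a + ν₂ b
  go a (acc rec) 1≤a with evenOdd a
  ... | even zero      = ⊥-elim (<-irrefl refl 1≤a)
  ... | even k@(suc _) = begin
    ν₂ (2 * k * b)     ≡⟨ cong ν₂ (*-assoc 2 k b) ⟩
    ν₂ (2 * (k * b))   ≡⟨ ν₂-2* (k * b) (*-mono-≤ {1} {k} (s≤s z≤n) 1≤b) ⟩
    1 + ν₂ (k * b)     ≡⟨ cong suc (go k (rec (n<2*n k (s≤s z≤n))) (s≤s z≤n)) ⟩
    1 + (ν₂ k + ν₂ b)  ≡⟨ cong (_+ ν₂ b) (ν₂-2* k (s≤s z≤n)) ⟨
    ν₂ (2 * k) + ν₂ b  ∎
  ... | odd k = trans (ν₂-odd* k b 1≤b) (sym (cong (_+ ν₂ b) (ν₂-1+2* k)))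

s₂-suc : ∀ n → s₂ (suc n) + ν₂ (suc n) ≡ suc (s₂ n)
s₂-suc n = go n (<-wellFounded n)
  where
  open ≡-Reasoning
  go : ∀ n → Acc _<_ n → s₂ (suc n) + ν₂ (suc n) ≡ suc (s₂ n)
  go n (acc rec) with evenOdd n
  ... | even k = begin
    s₂ (1 + 2 * k) + ν₂ (1 + 2 * k)  ≡⟨ cong₂ _+_ (s₂-1+2* k) (ν₂-1+2* k) ⟩
    1 + s₂ k + 0                     ≡⟨ +-identityʳ (1 + s₂ k) ⟩
    1 + s₂ k                         ≡⟨ cong suc (s₂-2* k) ⟨
    1 + s₂ (2 * k)                   ∎
  ... | odd k = begin
    s₂ (2 + 2 * k) + ν₂ (2 + 2 * k)      ≡⟨ cong (λ m → s₂ m + ν₂ m) (*-distribˡ-+ 2 1 k) ⟨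
    s₂ (2 * (1 + k)) + ν₂ (2 * (1 + k))  ≡⟨ cong₂ _+_ (s₂-2* (1 + k)) (ν₂-2* (1 + k) (s≤s z≤n)) ⟩
    s₂ (1 + k) + (1 + ν₂ (1 + k))        ≡⟨ +-suc (s₂ (1 + k)) (ν₂ (1 + k)) ⟩
    1 + (s₂ (1 + k) + ν₂ (1 + k))        ≡⟨ cong suc (go k (rec (s≤s (m≤m+n k (k + 0))))) ⟩
    2 + s₂ k                             ≡⟨ cong suc (s₂-1+2* k) ⟨
    1 + s₂ (1 + 2 * k)                   ∎

legendre : ∀ n → ν₂ (n !) + s₂ n ≡ n
legendre zero    = refl
legendre (suc n) = begin
  ν₂ (suc n * n !) + s₂ (suc n)          ≡⟨ cong (_+ s₂ (suc n)) (ν₂-* (suc n) (n !) (s≤s z≤n) (1≤n! n)) ⟩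
  ν₂ (suc n) + ν₂ (n !) + s₂ (suc n)     ≡⟨ xy∙z≈zx∙y (ν₂ (suc n)) (ν₂ (n !)) (s₂ (suc n)) ⟩
  (s₂ (suc n) + ν₂ (suc n)) + ν₂ (n !)   ≡⟨ cong (_+ ν₂ (n !)) (s₂-suc n) ⟩
  suc (s₂ n + ν₂ (n !))                  ≡⟨ cong suc (+-comm (s₂ n) (ν₂ (n !))) ⟩
  suc (ν₂ (n !) + s₂ n)                  ≡⟨ cong suc (legendre n) ⟩
  suc n                                  ∎
  where open ≡-Reasoning

C*[k!*[n∸k]!]≡n! : ∀ n k → k ≤ n → (n C k) * (k ! * (n ∸ k) !) ≡ n !
C*[k!*[n∸k]!]≡n! n k k≤n = trans (cong (_* (k ! * (n ∸ k) !)) (nCk≡n!/k![n-k]! k≤n))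
  (m/n*n≡m {{k !* (n ∸ k) !≢0}} (k![n∸k]!∣n! k≤n))

C-positive : ∀ n k → k ≤ n → 1 ≤ n C k
C-positive n k k≤n with n C k | C*[k!*[n∸k]!]≡n! n k k≤n
... | zero  | 0≡n! = ⊥-elim (<⇒≱ (1≤n! n) (≤-reflexive (sym 0≡n!)))
... | suc _ | _    = s≤s z≤n

kummer : ∀ n k → k ≤ n → ν₂ (n C k) + s₂ n ≡ s₂ k + s₂ (n ∸ k)
kummer n k k≤n = +-cancelʳ-≡ (A + B) _ _ (begin
  X + s₂ n + (A + B)              ≡⟨ rearrange₁ X (s₂ n) A B ⟩
  (X + A + B) + s₂ n              ≡⟨ cong (_+ s₂ n) ν₂[n!]≡X+A+B ⟨
  ν₂ (n !) + s₂ n                 ≡⟨ legendre n ⟩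
  n                               ≡⟨ m+[n∸m]≡n k≤n ⟨
  k + (n ∸ k)                     ≡⟨ cong₂ _+_ (legendre k) (legendre (n ∸ k)) ⟨
  (A + s₂ k) + (B + s₂ (n ∸ k))   ≡⟨ rearrange₂ A (s₂ k) B (s₂ (n ∸ k)) ⟩
  s₂ k + s₂ (n ∸ k) + (A + B)     ∎)
  where
  open ≡-Reasoning
  X = ν₂ (n C k)
  A = ν₂ (k !)
  B = ν₂ ((n ∸ k) !)
  1≤k!*[n∸k]! : 1 ≤ k ! * (n ∸ k) !
  1≤k!*[n∸k]! = *-mono-≤ {1} {k !} (1≤n! k) (1≤n! (n ∸ k))
  ν₂[n!]≡X+A+B : ν₂ (n !) ≡ X + A + B
  ν₂[n!]≡X+A+B = begin
    ν₂ (n !)                            ≡⟨ cong ν₂ (C*[k!*[n∸k]!]≡n! n k k≤n) ⟨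
    ν₂ ((n C k) * (k ! * (n ∸ k) !))   ≡⟨ ν₂-* _ _ (C-positive n k k≤n) 1≤k!*[n∸k]! ⟩
    X + ν₂ (k ! * (n ∸ k) !)           ≡⟨ cong (X +_) (ν₂-* (k !) _ (1≤n! k) (1≤n! (n ∸ k))) ⟩
    X + (A + B)                        ≡⟨ +-assoc X A B ⟨
    X + A + B                          ∎
  rearrange₁ : ∀ x s a b → x + s + (a + b) ≡ (x + a + b) + s
  rearrange₁ = solve-∀
  rearrange₂ : ∀ a b c d → (a + b) + (c + d) ≡ b + d + (a + c)
  rearrange₂ = solve-∀

ν₂-C≡0⇔s₂-additive : ∀ n k → k ≤ n → (ν₂ (n C k) ≡ 0 ⇔ s₂ (n ∸ k) + s₂ k ≡ s₂ n)
ν₂-C≡0⇔s₂-additive n k k≤n = mk⇔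
  (λ ν₂≡0 → sym (trans (cong (_+ s₂ n) (sym ν₂≡0)) balance))
  (λ additive → +-cancelʳ-≡ (s₂ n) _ 0 (trans balance additive))
  where
  balance : ν₂ (n C k) + s₂ n ≡ s₂ (n ∸ k) + s₂ k
  balance = trans (kummer n k k≤n) (+-comm (s₂ k) (s₂ (n ∸ k)))

a*[2*P]+2*j≡2*[a*P+j] : ∀ a P j → a * (2 * P) + 2 * j ≡ 2 * (a * P + j)
a*[2*P]+2*j≡2*[a*P+j] = solve-∀

a*[2*P]+[1+2*j]≡1+2*[a*P+j] : ∀ a P j → a * (2 * P) + (1 + 2 * j) ≡ 1 + 2 * (a * P + j)
a*[2*P]+[1+2*j]≡1+2*[a*P+j] = solve-∀

s₂-*2^+ : ∀ s a b → b < 2 ^ s → s₂ (a * 2 ^ s + b) ≡ s₂ a + s₂ b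
s₂-*2^+ zero a zero _ =
  trans (cong s₂ (trans (+-identityʳ (a * 1)) (*-identityʳ a))) (sym (+-identityʳ (s₂ a)))
s₂-*2^+ zero a (suc b) (s≤s ())
s₂-*2^+ (suc s) a b b<2P with evenOdd b
... | even j = begin
  s₂ (a * (2 * P) + 2 * j)  ≡⟨ cong s₂ (a*[2*P]+2*j≡2*[a*P+j] a P j) ⟩
  s₂ (2 * (a * P + j))      ≡⟨ s₂-2* (a * P + j) ⟩
  s₂ (a * P + j)            ≡⟨ s₂-*2^+ s a j (*-cancelˡ-< 2 j P b<2P) ⟩
  s₂ a + s₂ j               ≡⟨ cong (s₂ a +_) (s₂-2* j) ⟨
  s₂ a + s₂ (2 * j)         ∎
  where
  open ≡-Reasoning
  P = 2 ^ s
... | odd j = begin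
  s₂ (a * (2 * P) + (1 + 2 * j))  ≡⟨ cong s₂ (a*[2*P]+[1+2*j]≡1+2*[a*P+j] a P j) ⟩
  s₂ (1 + 2 * (a * P + j))        ≡⟨ s₂-1+2* (a * P + j) ⟩
  1 + s₂ (a * P + j)              ≡⟨ cong suc (s₂-*2^+ s a j j<P) ⟩
  1 + (s₂ a + s₂ j)               ≡⟨ +-suc (s₂ a) (s₂ j) ⟨
  s₂ a + (1 + s₂ j)               ≡⟨ cong (s₂ a +_) (s₂-1+2* j) ⟨
  s₂ a + s₂ (1 + 2 * j)           ∎
  where
  open ≡-Reasoning
  P = 2 ^ s
  j<P : j < P
  j<P = *-cancelˡ-< 2 j P (<-trans (n<1+n (2 * j)) b<2P)

ν₂-*2^+ : ∀ s a b → 1 ≤ b → b < 2 ^ s → ν₂ (a * 2 ^ s + b) ≡ ν₂ b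
ν₂-*2^+ zero    a b 1≤b b<1 = ⊥-elim (<⇒≱ b<1 1≤b)
ν₂-*2^+ (suc s) a b 1≤b b<2P with evenOdd b
... | even zero      = ⊥-elim (<-irrefl refl 1≤b)
... | even j@(suc _) = begin
  ν₂ (a * (2 * P) + 2 * j)  ≡⟨ cong ν₂ (a*[2*P]+2*j≡2*[a*P+j] a P j) ⟩
  ν₂ (2 * (a * P + j))      ≡⟨ ν₂-2* (a * P + j) (≤-trans (s≤s z≤n) (m≤n+m j (a * P))) ⟩
  1 + ν₂ (a * P + j)        ≡⟨ cong suc (ν₂-*2^+ s a j (s≤s z≤n) (*-cancelˡ-< 2 j P b<2P)) ⟩
  1 + ν₂ j                  ≡⟨ ν₂-2* j (s≤s z≤n) ⟨
  ν₂ (2 * j)                ∎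
  where
  open ≡-Reasoning
  P = 2 ^ s
... | odd j = begin
  ν₂ (a * (2 * P) + (1 + 2 * j))  ≡⟨ cong ν₂ (a*[2*P]+[1+2*j]≡1+2*[a*P+j] a P j) ⟩
  ν₂ (1 + 2 * (a * P + j))        ≡⟨ ν₂-1+2* (a * P + j) ⟩
  0                               ≡⟨ ν₂-1+2* j ⟨
  ν₂ (1 + 2 * j)                  ∎
  where
  open ≡-Reasoning
  P = 2 ^ s

s₂-complement-in-2^-1 : ∀ k a b → suc (a + b) ≡ 2 ^ k → s₂ a + s₂ b ≡ k
s₂-complement-in-2^-1 zero    zero    zero    _  = refl
s₂-complement-in-2^-1 zero    zero    (suc b) ()
s₂-complement-in-2^-1 zero    (suc a) b       ()
s₂-complement-in-2^-1 (suc k) a b eq with evenOdd a | evenOdd b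
... | even x | even y =
  ⊥-elim (1+2*m≢2*n (x + y) (2 ^ k) (trans (cong suc (*-distribˡ-+ 2 x y)) eq))
... | odd x  | odd y  =
  ⊥-elim (1+2*m≢2*n (1 + (x + y)) (2 ^ k) (trans (odd+odd x y) eq))
  where
  odd+odd : ∀ x y → 1 + 2 * (1 + (x + y)) ≡ suc ((1 + 2 * x) + (1 + 2 * y))
  odd+odd = solve-∀
... | even x | odd y  = begin
  s₂ (2 * x) + s₂ (1 + 2 * y)  ≡⟨ cong₂ _+_ (s₂-2* x) (s₂-1+2* y) ⟩
  s₂ x + (1 + s₂ y)            ≡⟨ +-suc (s₂ x) (s₂ y) ⟩
  1 + (s₂ x + s₂ y)            ≡⟨ cong suc (s₂-complement-in-2^-1 k x y (halve (even+odd x y))) ⟩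
  1 + k                        ∎
  where
  open ≡-Reasoning
  even+odd : ∀ x y → 2 * suc (x + y) ≡ suc (2 * x + (1 + 2 * y))
  even+odd = solve-∀
  halve : 2 * suc (x + y) ≡ suc (a + b) → suc (x + y) ≡ 2 ^ k
  halve e = *-cancelˡ-≡ (suc (x + y)) (2 ^ k) 2 (trans e eq)
... | odd x  | even y = begin
  s₂ (1 + 2 * x) + s₂ (2 * y)  ≡⟨ cong₂ _+_ (s₂-1+2* x) (s₂-2* y) ⟩
  1 + (s₂ x + s₂ y)            ≡⟨ cong suc (s₂-complement-in-2^-1 k x y (halve (odd+even x y))) ⟩
  1 + k                        ∎
  where
  open ≡-Reasoning
  odd+even : ∀ x y → 2 * suc (x + y) ≡ suc ((1 + 2 * x) + 2 * y)
  odd+even = solve-∀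
  halve : 2 * suc (x + y) ≡ suc (a + b) → suc (x + y) ≡ 2 ^ k
  halve e = *-cancelˡ-≡ (suc (x + y)) (2 ^ k) 2 (trans e eq)

s₂-complement-in-2^ : ∀ k r r' → 1 ≤ r → r + r' ≡ 2 ^ k → s₂ r + s₂ r' + ν₂ r ≡ suc k
s₂-complement-in-2^ k (suc r) r' _ eq = begin
  s₂ (suc r) + s₂ r' + ν₂ (suc r)    ≡⟨ xy∙z≈xz∙y (s₂ (suc r)) (s₂ r') (ν₂ (suc r)) ⟩
  s₂ (suc r) + ν₂ (suc r) + s₂ r'    ≡⟨ cong (_+ s₂ r') (s₂-suc r) ⟩
  suc (s₂ r + s₂ r')                 ≡⟨ cong suc (s₂-complement-in-2^-1 k r r' eq) ⟩
  suc k                              ∎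
  where open ≡-Reasoning

s₂-*2^ : ∀ s a → s₂ (a * 2 ^ s) ≡ s₂ a
s₂-*2^ s a = trans (cong s₂ (sym (+-identityʳ (a * 2 ^ s))))
  (trans (s₂-*2^+ s a 0 (m^n>0 2 s)) (+-identityʳ (s₂ a)))

s₂-odd : ∀ n → suc n % 2 ≡ 1 → s₂ (suc n) ≡ suc (s₂ n)
s₂-odd n n%2≡1 = begin
  s₂ (suc n)                ≡⟨ +-identityʳ (s₂ (suc n)) ⟨
  s₂ (suc n) + 0            ≡⟨ cong (s₂ (suc n) +_) (ν₂-odd (suc n) n%2≡1) ⟨
  s₂ (suc n) + ν₂ (suc n)   ≡⟨ s₂-suc n ⟩
  suc (s₂ n)                ∎
  where open ≡-Reasoning

ν₂<⇒remainder-positive : ∀ s i q r → i ≡ r + q * 2 ^ s → 1 ≤ i → ν₂ i < s → 1 ≤ r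
ν₂<⇒remainder-positive s i q       (suc r) _      _   _    = s≤s z≤n
ν₂<⇒remainder-positive s i zero    zero    i≡0    1≤i _    = ⊥-elim (<-irrefl (sym i≡0) 1≤i)
ν₂<⇒remainder-positive s i (suc q) zero    i≡q*P  _   ν₂i<s = ⊥-elim (<⇒≱ ν₂i<s s≤ν₂i)
  where
  s≤ν₂i : s ≤ ν₂ i
  s≤ν₂i = subst (s ≤_)
    (sym (trans (cong ν₂ i≡q*P) (trans (ν₂-* (suc q) (2 ^ s) (s≤s z≤n) (m^n>0 2 s))
                                        (cong (ν₂ (suc q) +_) (ν₂-2^ s)))))
    (m≤n+m s (ν₂ (suc q)))

[1+m]*P∸[q*P+r]≡[m∸q]*P+[P∸r] : ∀ m P q r → q ≤ m → r ≤ P →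
  suc m * P ∸ (q * P + r) ≡ (m ∸ q) * P + (P ∸ r)
[1+m]*P∸[q*P+r]≡[m∸q]*P+[P∸r] m P q r q≤m r≤P = begin
  suc m * P ∸ (q * P + r)                               ≡⟨ cong (_∸ (q * P + r)) split ⟨
  (q * P + r) + ((m ∸ q) * P + (P ∸ r)) ∸ (q * P + r)   ≡⟨ m+n∸m≡n (q * P + r) _ ⟩
  (m ∸ q) * P + (P ∸ r)                                 ∎
  where
  open ≡-Reasoning
  regroup : ∀ q P r p r' → (q * P + r) + (p * P + r') ≡ (q + p) * P + (r + r')
  regroup = solve-∀
  split : (q * P + r) + ((m ∸ q) * P + (P ∸ r)) ≡ suc m * P
  split = begin
    (q * P + r) + ((m ∸ q) * P + (P ∸ r))   ≡⟨ regroup q P r (m ∸ q) (P ∸ r) ⟩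
    (q + (m ∸ q)) * P + (r + (P ∸ r))
      ≡⟨ cong₂ (λ x y → x * P + y) (m+[n∸m]≡n q≤m) (m+[n∸m]≡n r≤P) ⟩
    m * P + P                               ≡⟨ +-comm (m * P) P ⟩
    suc m * P                               ∎

ν₂-C-odd*2^ : ∀ c s i → c % 2 ≡ 1 → 1 ≤ i → i < c * 2 ^ s → ν₂ i < s →
  ν₂ ((c * 2 ^ s) C i) ≡ ν₂ ((c ∸ 1) C ⌊ i /2^ s ⌋) + (s ∸ ν₂ i)
ν₂-C-odd*2^ (suc m) s i c-odd 1≤i i<n ν₂i<s = +-cancelʳ-≡ (ν₂ i) _ _ (begin
  V + ν₂ i              ≡⟨ balance ⟩
  E + s                 ≡⟨ cong (E +_) (m∸n+n≡m (<⇒≤ ν₂i<s)) ⟨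
  E + (s ∸ ν₂ i + ν₂ i) ≡⟨ +-assoc E (s ∸ ν₂ i) (ν₂ i) ⟨
  E + (s ∸ ν₂ i) + ν₂ i ∎)
  where
  open ≡-Reasoning
  P = 2 ^ s
  instance
    P≢0 : NonZero P
    P≢0 = m^n≢0 2 s
  n = suc m * P
  q = ⌊ i /2^ s ⌋
  r = i % P
  p = m ∸ q
  r' = P ∸ r
  V = ν₂ (n C i)
  E = ν₂ (m C q)
  r<P : r < P
  r<P = m%n<n i P
  q≤m : q ≤ m
  q≤m = s≤s⁻¹ (m<n*o⇒m/o<n {i} {suc m} {P} i<n)
  1≤r : 1 ≤ r
  1≤r = ν₂<⇒remainder-positive s i q r (m≡m%n+[m/n]*n i P) 1≤i ν₂i<s
  r'<P : r' < P
  r'<P = ∸-monoʳ-< {P} {r} {0} 1≤r (<⇒≤ r<P)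
  i≡q*P+r : i ≡ q * P + r
  i≡q*P+r = trans (m≡m%n+[m/n]*n i P) (+-comm r (q * P))
  n∸i≡p*P+r' : n ∸ i ≡ p * P + r'
  n∸i≡p*P+r' = trans (cong (n ∸_) i≡q*P+r)
    ([1+m]*P∸[q*P+r]≡[m∸q]*P+[P∸r] m P q r q≤m (<⇒≤ r<P))
  s₂i : s₂ i ≡ s₂ q + s₂ r
  s₂i = trans (cong s₂ i≡q*P+r) (s₂-*2^+ s q r r<P)
  s₂[n∸i] : s₂ (n ∸ i) ≡ s₂ p + s₂ r'
  s₂[n∸i] = trans (cong s₂ n∸i≡p*P+r') (s₂-*2^+ s p r' r'<P)
  ν₂i : ν₂ i ≡ ν₂ r
  ν₂i = trans (cong ν₂ i≡q*P+r) (ν₂-*2^+ s q r 1≤r r<P)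
  s₂n : s₂ n ≡ suc (s₂ m)
  s₂n = trans (s₂-*2^ s (suc m)) (s₂-odd m c-odd)
  low-digits : s₂ r + s₂ r' + ν₂ r ≡ suc s
  low-digits = s₂-complement-in-2^ s r r' 1≤r (m+[n∸m]≡n (<⇒≤ r<P))
  regroup₁ : ∀ a b c d e → (a + b) + (c + d) + e ≡ (a + c) + (b + d + e)
  regroup₁ = solve-∀
  regroup₂ : ∀ e a s → e + a + suc s ≡ e + s + suc a
  regroup₂ = solve-∀
  balance : V + ν₂ i ≡ E + s
  balance = +-cancelʳ-≡ (s₂ n) _ _ (begin
    V + ν₂ i + s₂ n                          ≡⟨ xy∙z≈xz∙y V (ν₂ i) (s₂ n) ⟩
    V + s₂ n + ν₂ i                          ≡⟨ cong₂ _+_ (kummer n i (<⇒≤ i<n)) ν₂i ⟩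
    s₂ i + s₂ (n ∸ i) + ν₂ r                 ≡⟨ cong₂ (λ x y → x + y + ν₂ r) s₂i s₂[n∸i] ⟩
    (s₂ q + s₂ r) + (s₂ p + s₂ r') + ν₂ r    ≡⟨ regroup₁ (s₂ q) (s₂ r) (s₂ p) (s₂ r') (ν₂ r) ⟩
    (s₂ q + s₂ p) + (s₂ r + s₂ r' + ν₂ r)    ≡⟨ cong₂ _+_ (sym (kummer m q q≤m)) low-digits ⟩
    E + s₂ m + suc s                         ≡⟨ regroup₂ E (s₂ m) s ⟩
    E + s + suc (s₂ m)                       ≡⟨ cong (E + s +_) s₂n ⟨
    E + s + s₂ n                             ∎)


s≤ν₂[C]+ν₂ : ∀ c s i → c % 2 ≡ 1 → 1 ≤ i → i < c * 2 ^ s → s ≤ ν₂ ((c * 2 ^ s) C i) + ν₂ i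
s≤ν₂[C]+ν₂ c s i c-odd 1≤i i<n with s ≤? ν₂ i
... | yes s≤ν₂i = ≤-trans s≤ν₂i (m≤n+m (ν₂ i) _)
... | no  s≰ν₂i = begin
  s                               ≡⟨ m∸n+n≡m ν₂i≤s ⟨
  s ∸ ν₂ i + ν₂ i                 ≤⟨ +-monoˡ-≤ (ν₂ i) (m≤n+m (s ∸ ν₂ i) _) ⟩
  _ + (s ∸ ν₂ i) + ν₂ i           ≡⟨ cong (_+ ν₂ i) (ν₂-C-odd*2^ c s i c-odd 1≤i i<n ν₂i<s) ⟨
  ν₂ ((c * 2 ^ s) C i) + ν₂ i     ∎
  where
  open ≤-Reasoning
  ν₂i<s = ≰⇒> s≰ν₂i
  ν₂i≤s = <⇒≤ ν₂i<s

m≡n+o⇒[m≡o⇔n≡0] : ∀ {m n o} → m ≡ n + o → (m ≡ o ⇔ n ≡ 0)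
m≡n+o⇒[m≡o⇔n≡0] {n = n} {o} m≡n+o = mk⇔
  (λ m≡o → +-cancelʳ-≡ o n 0 (trans (sym m≡n+o) m≡o))
  (λ n≡0 → trans m≡n+o (cong (_+ o) n≡0))

ν₂+6≤2* : ∀ i → 3 ≤ i → ν₂ i + 6 ≤ 2 * i
ν₂+6≤2* 1 (s≤s ())
ν₂+6≤2* 2 (s≤s (s≤s ()))
ν₂+6≤2* 3 _ = ≤-refl
ν₂+6≤2* 4 _ = ≤-refl
ν₂+6≤2* i@(suc (suc (suc (suc (suc j))))) _ = begin
  ν₂ i + 6        ≡⟨ +-comm (ν₂ i) 6 ⟩
  5 + suc (ν₂ i)  ≤⟨ +-monoʳ-≤ 5 (ν₂[n]<n i (s≤s z≤n)) ⟩
  5 + i           ≤⟨ +-monoˡ-≤ i (s≤s (s≤s (s≤s (s≤s (s≤s z≤n))))) ⟩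
  i + i           ≡⟨ cong (i +_) (+-identityʳ i) ⟨
  2 * i           ∎
  where open ≤-Reasoning

s+6≤ν₂[2^[t*i]*C] : ∀ c s i t → c % 2 ≡ 1 → 3 ≤ i → i < c * 2 ^ s → t ≥ 2 →
  ν₂ (2 ^ (t * i) * ((c * 2 ^ s) C i)) ≥ s + 6
s+6≤ν₂[2^[t*i]*C] c s i t c-odd 3≤i i<n 2≤t = begin
  s + 6                        ≤⟨ +-monoˡ-≤ 6 (s≤ν₂[C]+ν₂ c s i c-odd 1≤i i<n) ⟩
  V + ν₂ i + 6                 ≡⟨ +-assoc V (ν₂ i) 6 ⟩
  V + (ν₂ i + 6)               ≤⟨ +-monoʳ-≤ V (ν₂+6≤2* i 3≤i) ⟩
  V + 2 * i                    ≤⟨ +-monoʳ-≤ V (*-monoˡ-≤ i 2≤t) ⟩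
  V + t * i                    ≡⟨ +-comm V (t * i) ⟩
  t * i + V                    ≡⟨ cong (_+ V) (ν₂-2^ (t * i)) ⟨
  ν₂ (2 ^ (t * i)) + V         ≡⟨ ν₂-* (2 ^ (t * i)) ((c * 2 ^ s) C i) (m^n>0 2 (t * i)) 1≤C ⟨
  ν₂ (2 ^ (t * i) * ((c * 2 ^ s) C i)) ∎
  where
  open ≤-Reasoning
  V = ν₂ ((c * 2 ^ s) C i)
  1≤i = ≤-trans (s≤s z≤n) 3≤i
  1≤C = C-positive (c * 2 ^ s) i (<⇒≤ i<n)

lemma2p11 : (c i s t : ℕ) → 1 ≤ c → c % 2 ≡ 1 →
    ((1 ≤ i → i < c * 2 ^ s → ν₂ i < s →
        (ν₂ ((c * 2 ^ s) C i) ≥ s ∸ ν₂ i)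
        × ((ν₂ ((c * 2 ^ s) C i) ≡ s ∸ ν₂ i)
           ⇔ (s₂ (c ∸ 1 ∸ ⌊ i /2^ s ⌋) + s₂ (⌊ i /2^ s ⌋) ≡ s₂ (c ∸ 1))))
    × (3 ≤ i → i < c * 2 ^ s → t ≥ 2 →
        ν₂ (2 ^ (t * i) * ((c * 2 ^ s) C i)) ≥ s + 6))
lemma2p11 c i s t _ c-odd = part-i , s+6≤ν₂[2^[t*i]*C] c s i t c-odd
  where
  part-i : 1 ≤ i → i < c * 2 ^ s → ν₂ i < s →
    (ν₂ ((c * 2 ^ s) C i) ≥ s ∸ ν₂ i) ×
    ((ν₂ ((c * 2 ^ s) C i) ≡ s ∸ ν₂ i) ⇔ (s₂ (c ∸ 1 ∸ ⌊ i /2^ s ⌋) + s₂ ⌊ i /2^ s ⌋ ≡ s₂ (c ∸ 1)))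
  part-i 1≤i i<n ν₂i<s =
    ≤-trans (m≤n+m (s ∸ ν₂ i) _) (≤-reflexive (sym V≡E+d)) ,
    ⇔-trans (m≡n+o⇒[m≡o⇔n≡0] V≡E+d) (ν₂-C≡0⇔s₂-additive (c ∸ 1) q q≤c∸1)
    where
    instance _ = m^n≢0 2 s
    q = ⌊ i /2^ s ⌋
    q≤c∸1 : q ≤ c ∸ 1
    q≤c∸1 = <⇒≤pred (m<n*o⇒m/o<n {i} {c} {2 ^ s} i<n)
    V≡E+d : ν₂ ((c * 2 ^ s) C i) ≡ ν₂ ((c ∸ 1) C q) + (s ∸ ν₂ i)
    V≡E+d = ν₂-C-odd*2^ c s i c-odd 1≤i i<n ν₂i<s
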